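{- For $n\ge 1$, $a_n(21;1\to 3)=2^{n-1}$.
   Context: Standard cycle form of $\sigma\in S_n$: product of disjoint cycles (fixed points included), each cycle starting with its largest element, cycles listed in increasing order of largest elements. The fundamental bijection $\theta:S_n\to S_n$ erases the parentheses of the standard cycle form to give a one-line permutation. For $\pi\in S_n$, $\hat\pi=\theta^{ -1}(\pi)$. An arrow pattern $(\nu;H)$ of size $k$: a string $\nu=a_1\dots a_m$ of positive integers and a set $H$ of arrows $b\to c$, with all integers appearing forming $[k]$. $\pi\in S_n$ contains $(\nu;H)$ if there is $X=\{x_1<\dots<x_k\}\subseteq[n]$ with positions $t_1<\dots<t_m$ such that $\pi_{t_1}\cdots\pi_{t_m}=x_{a_1}\cdots x_{a_m}$ and $\hat\pi(x_b)=x_c$ for every arrow $b\to c\in H$; otherwise it avoids it. $a_n(\nu;H)$ = number of $\pi\in S_n$ avoiding $(\nu;H)$. -}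

module Defs where

open import Data.Nat using (ℕ)
open import Data.Fin using (Fin; _<_)
open import Data.Fin using (zero; suc)
open import Data.Vec using (Vec; lookup)
open import Data.List using (List; []; _∷_; map; concat; length; allFin)
open import Data.List.NonEmpty using (List⁺; _∷_; head; toList)
open import Data.List.Relation.Unary.All using (All)
open import Data.List.Relation.Unary.Linked using (Linked)
open import Data.List.Relation.Unary.Unique.Propositional using (Unique)
open import Data.List.Relation.Binary.Permutation.Propositional using (_↭_)
open import Data.List.Membership.Propositional using (_∈_)
open import Data.Product using (Σ; ∃; _×_)
open import Relation.Binary.PropositionalEquality using (_≡_)
open import Relation.Nullary using (¬_)
open import Function.Bundles using (_⇔_)

-- Elements of [n] are represented by Fin n (0-based; order preserved).

-- One-line notation: a word of length n over [n] with distinct letters.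
IsPerm : ∀ {n} → Vec (Fin n) n → Set
IsPerm {n} π = ∀ (i j : Fin n) → lookup π i ≡ lookup π j → i ≡ j

CycleChain : ∀ {n} → (Fin n → Fin n) → Fin n → List (Fin n) → Set
CycleChain σ first []           = σ first ≡ first   -- unused for nonempty tails
CycleChain σ first (x ∷ [])     = σ x ≡ first
CycleChain σ first (x ∷ y ∷ r)  = σ x ≡ y × CycleChain σ first (y ∷ r)

IsStdCycle : ∀ {n} → (Fin n → Fin n) → List⁺ (Fin n) → Set
IsStdCycle σ (h ∷ t) = All (λ y → y < h) t × CycleChain σ h (h ∷ t)

-- Standard cycle form of σ: disjoint cycles covering [n] (fixed points included),
-- each starting with its largest element, ordered by increasing largest elements.
StdCycleForm : ∀ {n} → (Fin n → Fin n) → List (List⁺ (Fin n)) → Set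
StdCycleForm {n} σ cs =
  All (IsStdCycle σ) cs ×
  Linked _<_ (map head cs) ×
  (concat (map toList cs) ↭ allFin n)

Theta : ∀ {n} → (Fin n → Fin n) → Vec (Fin n) n → Set
Theta σ π = Σ _ λ cs → StdCycleForm σ cs × (concat (map toList cs) ≡ Data.Vec.toList π)

StrictInc : ∀ {k n} → (Fin k → Fin n) → Set
StrictInc {k} f = ∀ (i j : Fin k) → i < j → f i < f j

-- X = {x_1 < … < x_k} is encoded by the strictly increasing map x,
-- positions t_1 < … < t_m by the strictly increasing map t,
-- and π̂ = θ⁻¹(π) is the σ with θ(σ) = π.
Contains : ∀ {n k m} → Vec (Fin k) m → List (Fin k × Fin k) → Vec (Fin n) n → Set
Contains {n} {k} {m} ν H π =
  Σ (Fin k → Fin n) λ x → StrictInc x ×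
  Σ (Fin m → Fin n) λ t → StrictInc t ×
  (∀ (i : Fin m) → lookup π (t i) ≡ x (lookup ν i)) ×
  Σ (Fin n → Fin n) λ σ → Theta σ π ×
  All (λ bc → σ (x (Data.Product.proj₁ bc)) ≡ x (Data.Product.proj₂ bc)) H

Avoids : ∀ {n k m} → Vec (Fin k) m → List (Fin k × Fin k) → Vec (Fin n) n → Set
Avoids ν H π = ¬ Contains ν H π

HasCount : {A : Set} → (A → Set) → ℕ → Set
HasCount {A} P c =
  Σ (List A) λ L → Unique L × (∀ a → (a ∈ L) ⇔ P a) × length L ≡ c

AvoidCount : (n : ℕ) → ∀ {k m} → Vec (Fin k) m → List (Fin k × Fin k) → ℕ → Set
AvoidCount n ν H c = HasCount (λ (π : Vec (Fin n) n) → IsPerm π × Avoids ν H π) c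

-- The arrow pattern (21 ; 1→3) of size 3 (0-based letters: 1 ↦ 0, 2 ↦ 1, 3 ↦ 2).
ν21 : Vec (Fin 3) 2
ν21 = Data.Vec._∷_ (suc zero) (Data.Vec._∷_ zero Data.Vec.[])

H13 : List (Fin 3 × Fin 3)
H13 = Data.Product._,_ zero (suc (suc zero)) ∷ []

-- Read a permutation π of [n] as a word w over ℕ, and θ⁻¹(π) as the successor map of the standard
-- cycle form of w. The letter n-1 heads the last cycle, which is the whole suffix of w after it.
-- If π avoids (21;1→3), that suffix is a run ℓ, ℓ+1, …, n-2. To see this, build the run from the
-- right: if the letter c in front of the run m, …, n-2 found so far were not m-1, then m-1 would
-- stand to the left of c, and c < m-1 < m = θ⁻¹(π)(c) would be an occurrence of the pattern. The
-- prefix is again an avoider, so the avoiders are exactly the block words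
-- u (ℓ+k) ℓ (ℓ+1) … (ℓ+k-1) with u a block word of size ℓ. Conversely, in a block word
-- θ⁻¹(π)(a) ≤ a+1 for every a, so no letter fits strictly between a and θ⁻¹(π)(a). Block words of
-- size n correspond to compositions of n, and there are 2^(n-1) of these.
module Submission where

open import Defs
open import Data.Empty using (⊥; ⊥-elim)
open import Data.Fin as Fin using (Fin; zero; suc; toℕ)
open import Data.Fin.Properties as Finₚ using (toℕ-injective; toℕ<n; toℕ-fromℕ<)
open import Data.List as List using (List; []; _∷_; _++_; [_]; map; concat; length)
open import Data.List.Membership.Propositional using (_∈_; _∉_)
open import Data.List.Membership.Propositional.Properties
  using (∈-++⁺ˡ; ∈-++⁺ʳ; ∈-++⁻; ∈-map⁺; ∈-map⁻; ∈-∃++; ∈-concat⁻′; ∈-concat⁺′; ∈-allFin)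
open import Data.List.Membership.Propositional.Properties.WithK using (unique∧set⇒bag)
open import Data.List.NonEmpty as List⁺ using (List⁺; _∷_; head; tail; toList)
open import Data.List.Properties
  using (∷-injective; ∷-injectiveˡ; ∷-injectiveʳ; ++-assoc; ++-identityʳ; map-++; length-map; length-++)
open import Data.List.Relation.Binary.BagAndSetEquality using (∼bag⇒↭)
open import Data.List.Relation.Binary.Permutation.Propositional using (_↭_; ↭-sym)
open import Data.List.Relation.Binary.Permutation.Propositional.Properties using (∈-resp-↭)
open import Data.List.Relation.Unary.All as All using (All; []; _∷_)
import Data.List.Relation.Unary.All.Properties as Allₚ
open import Data.List.Relation.Unary.AllPairs using ([]; _∷_)
open import Data.List.Relation.Unary.Any using (here; there)
open import Data.List.Relation.Unary.Linked as Linked using (Linked; []; [-]; _∷_)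
import Data.List.Relation.Unary.Linked.Properties as Linkedₚ
open import Data.List.Relation.Unary.Unique.Propositional using (Unique)
import Data.List.Relation.Unary.Unique.Propositional.Properties as Uniqueₚ
open import Data.Nat
  using (ℕ; zero; suc; pred; _+_; _∸_; _^_; _≤_; _<_; _≥_; z≤n; s≤s; s≤s⁻¹; z<s; s<s; _<?_; _≟_;
         >-nonZero)
open import Data.Nat.DivMod using (_mod_; m<n⇒m%n≡m)
open import Data.Nat.Induction using (<-wellFounded)
open import Data.Nat.Properties
open import Data.Product using (∃; ∃₂; _×_; _,_; proj₁; proj₂)
open import Data.Sum using (inj₁; inj₂)
open import Data.Vec as Vec using (Vec; []; _∷_; lookup)
open import Data.Vec.Membership.Propositional.Properties using (∈-toList⁻; ∈-toList⁺; ∈-lookup)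
import Data.Vec.Properties as Vecₚ
open import Data.Vec.Relation.Unary.All using ([]; _∷_)
import Data.Vec.Relation.Unary.All.Properties as VecAllₚ
open import Data.Vec.Relation.Unary.AllPairs using ([]; _∷_) renaming (AllPairs to VecAllPairs)
import Data.Vec.Relation.Unary.Any as VecAny
import Data.Vec.Relation.Unary.Any.Properties as VecAnyₚ
open import Data.Vec.Relation.Unary.Unique.Propositional using () renaming (Unique to VecUnique)
import Data.Vec.Relation.Unary.Unique.Propositional.Properties as VecUniqueₚ
open import Function using (_∘_; _on_)
open import Function.Bundles using (_⇔_; mk⇔; Equivalence)
open import Induction.WellFounded using (Acc; acc)
open import Relation.Binary.PropositionalEquality hiding ([_])
open import Relation.Nullary using (¬_; Dec; yes; no)

module _ {A : Set} where

  Before : A → A → List A → Set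
  Before b a w = ∃₂ λ l r → w ≡ l ++ a ∷ r × b ∈ l

  Adjacent : A → A → List A → Set
  Adjacent a c w = ∃₂ λ l r → w ≡ l ++ a ∷ c ∷ r

  Before-++ʳ : ∀ {a b u} v → Before b a u → Before b a (u ++ v)
  Before-++ʳ v (l , r , refl , b∈l) = l , r ++ v , ++-assoc l (_ ∷ r) v , b∈l

  Unique-++⁻ˡ : ∀ (xs : List A) {ys} → Unique (xs ++ ys) → Unique xs
  Unique-++⁻ˡ []       _        = []
  Unique-++⁻ˡ (x ∷ xs) (x∉ ∷ u) = Allₚ.++⁻ˡ xs x∉ ∷ Unique-++⁻ˡ xs u

  Unique-++⁻ʳ : ∀ (xs : List A) {ys} → Unique (xs ++ ys) → Unique ys
  Unique-++⁻ʳ []       u       = u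
  Unique-++⁻ʳ (x ∷ xs) (_ ∷ u) = Unique-++⁻ʳ xs u

  Unique-++-disjoint : ∀ (xs : List A) {ys x} → Unique (xs ++ ys) → x ∈ xs → x ∉ ys
  Unique-++-disjoint (y ∷ xs) (y∉ ∷ _) (here refl)  x∈ys = All.lookup (Allₚ.++⁻ʳ xs y∉) x∈ys refl
  Unique-++-disjoint (y ∷ xs) (_ ∷ u)  (there x∈xs) x∈ys = Unique-++-disjoint xs u x∈xs x∈ys

  Unique-map⁺-on : ∀ {B : Set} (g : A → B) {xs : List A} →
                   (∀ {x y} → x ∈ xs → y ∈ xs → g x ≡ g y → x ≡ y) → Unique xs → Unique (map g xs)
  Unique-map⁺-on g {[]}     _   []       = []
  Unique-map⁺-on g {x ∷ xs} inj (x∉ ∷ u) =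
    Allₚ.map⁺ (All.tabulate λ y∈ gx≡gy → All.lookup x∉ y∈ (inj (here refl) (there y∈) gx≡gy)) ∷
    Unique-map⁺-on g (λ x∈ y∈ → inj (there x∈) (there y∈)) u

  split-in-suffix : ∀ (xs : List A) {ys u a t} → a ∉ xs → xs ++ ys ≡ u ++ a ∷ t →
                    ∃ λ u′ → u ≡ xs ++ u′ × ys ≡ u′ ++ a ∷ t
  split-in-suffix []       _  eq = _ , refl , eq
  split-in-suffix (x ∷ xs) {u = []}    a∉ refl = ⊥-elim (a∉ (here refl))
  split-in-suffix (x ∷ xs) {u = y ∷ u} a∉ eq with ∷-injective eq
  ... | refl , eq′ with split-in-suffix xs (a∉ ∘ there) eq′
  ... | u′ , refl , eq″ = u′ , refl , eq″

  split-unique : ∀ (l : List A) {l′ a r r′} → a ∉ l → a ∉ l′ → l ++ a ∷ r ≡ l′ ++ a ∷ r′ →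
                 l ≡ l′ × r ≡ r′
  split-unique l a∉l a∉l′ eq with split-in-suffix l a∉l eq
  ... | []    , refl , refl = sym (++-identityʳ l) , refl
  ... | _ ∷ _ , refl , eq′ with ∷-injectiveˡ eq′
  ...   | refl = ⊥-elim (a∉l′ (∈-++⁺ʳ l (here refl)))

  Linked-++⁻ˡ : ∀ {R : A → A → Set} (xs : List A) {ys} → Linked R (xs ++ ys) → Linked R xs
  Linked-++⁻ˡ []           _        = []
  Linked-++⁻ˡ (x ∷ [])     _        = [-]
  Linked-++⁻ˡ (x ∷ y ∷ xs) (r ∷ rs) = r ∷ Linked-++⁻ˡ (y ∷ xs) rs

  Linked-Adjacent : ∀ {R : A → A → Set} {ys a c} → Linked R ys → Adjacent a c ys → R a c
  Linked-Adjacent lk ([]    , _ , refl) = Linked.head lk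
  Linked-Adjacent lk (_ ∷ l , r , refl) = Linked-Adjacent (Linked.tail lk) (l , r , refl)

  ∈⇒Adjacent-snoc : ∀ (xs : List A) f {a} → a ∈ xs → ∃ λ c → Adjacent a c (xs ++ [ f ])
  ∈⇒Adjacent-snoc (x ∷ [])    f (here refl) = f , [] , [] , refl
  ∈⇒Adjacent-snoc (x ∷ y ∷ r) f (here refl) = y , [] , r ++ [ f ] , refl
  ∈⇒Adjacent-snoc (x ∷ y ∷ r) f (there a∈) with ∈⇒Adjacent-snoc (y ∷ r) f a∈
  ... | c , l , r′ , eq = c , x ∷ l , r′ , cong (x ∷_) eq

  links : List A → List (A × A)
  links []          = []
  links (x ∷ [])    = []
  links (x ∷ y ∷ r) = (x , y) ∷ links (y ∷ r)

  keys-links : ∀ (xs : List A) f → map proj₁ (links (xs ++ [ f ])) ≡ xs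
  keys-links []          f = refl
  keys-links (x ∷ [])    f = refl
  keys-links (x ∷ y ∷ r) f = cong (x ∷_) (keys-links (y ∷ r) f)

  All-links⇒Linked : ∀ {R : A → A → Set} (ys : List A) → All (λ (a , b) → R a b) (links ys) → Linked R ys
  All-links⇒Linked []          _          = []
  All-links⇒Linked (x ∷ [])    _          = [-]
  All-links⇒Linked (x ∷ y ∷ r) (Rxy ∷ rs) = Rxy ∷ All-links⇒Linked (y ∷ r) rs

  flatten : List (List⁺ A) → List A
  flatten cs = concat (map toList cs)

  HeadsMax : (A → A → Set) → List (List⁺ A) → Set
  HeadsMax _<_ = All (λ C → All (_< head C) (tail C))

Adjacent-map : ∀ {A B : Set} (g : A → B) {a c xs} → Adjacent a c xs → Adjacent (g a) (g c) (map g xs)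
Adjacent-map g (l , r , refl) = map g l , map g r , map-++ g l _

Adjacent-map⁻ : ∀ {A B : Set} (g : A → B) ys {x y} → Adjacent x y (map g ys) →
                ∃₂ λ a c → Adjacent a c ys × g a ≡ x × g c ≡ y
Adjacent-map⁻ g []           ([]    , _ , ())
Adjacent-map⁻ g []           (_ ∷ _ , _ , ())
Adjacent-map⁻ g (a ∷ [])     ([]    , _ , eq) with ∷-injectiveʳ eq
... | ()
Adjacent-map⁻ g (a ∷ c ∷ ys) ([]    , _ , refl) = a , c , ([] , ys , refl) , refl , refl
Adjacent-map⁻ g (z ∷ ys)     (_ ∷ l , r , eq) with Adjacent-map⁻ g ys (l , r , ∷-injectiveʳ eq)
... | a , c , (l′ , r′ , refl) , ga≡x , gc≡y = a , c , (z ∷ l′ , r′ , refl) , ga≡x , gc≡y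

HasCount-retract : ∀ {A B : Set} {P : A → Set} {Q : B → Set} {c} (f : B → A) (g : A → B) →
                   (∀ b → g (f b) ≡ b) → (∀ {a} → P a → f (g a) ≡ a) → (∀ b → Q b ⇔ P (f b)) →
                   HasCount P c → HasCount Q c
HasCount-retract {P = P} {Q} f g g∘f≗id f∘g≗id Q⇔P (L , unique , L⇔P , length≡c) =
  map g L ,
  Unique-map⁺-on g (λ a∈ a′∈ ga≡ga′ → trans (sym (f∘g∈L a∈)) (trans (cong f ga≡ga′) (f∘g∈L a′∈)))
                 unique ,
  (λ b → mk⇔ to from) ,
  trans (length-map g L) length≡c
  where
  f∘g∈L : ∀ {a} → a ∈ L → f (g a) ≡ a
  f∘g∈L a∈ = f∘g≗id (Equivalence.to (L⇔P _) a∈)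
  to : ∀ {b} → b ∈ map g L → Q b
  to b∈ with ∈-map⁻ g b∈
  ... | a , a∈ , refl =
    Equivalence.from (Q⇔P (g a)) (subst P (sym (f∘g∈L a∈)) (Equivalence.to (L⇔P a) a∈))
  from : ∀ {b} → Q b → b ∈ map g L
  from {b} qb =
    subst (_∈ map g L) (g∘f≗id b) (∈-map⁺ g (Equivalence.from (L⇔P (f b)) (Equivalence.to (Q⇔P b) qb)))

-- Runs and block words

range : ℕ → ℕ → List ℕ
range m zero    = []
range m (suc k) = m ∷ range (suc m) k

∈-range⁻ : ∀ m k {x} → x ∈ range m k → m ≤ x × x < m + k
∈-range⁻ m (suc k) (here refl) = ≤-refl , m<m+n m z<s
∈-range⁻ m (suc k) {x} (there x∈) with ∈-range⁻ (suc m) k x∈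
... | m<x , x<m+k = <⇒≤ m<x , subst (x <_) (sym (+-suc m k)) x<m+k

∈-range⁺ : ∀ m k {x} → m ≤ x → x < m + k → x ∈ range m k
∈-range⁺ m zero    m≤x x<m = ⊥-elim (<⇒≱ (subst (_ <_) (+-identityʳ m) x<m) m≤x)
∈-range⁺ m (suc k) {x} m≤x x<m+k with m ≟ x
... | yes refl = here refl
... | no  m≢x  = there (∈-range⁺ (suc m) k (≤∧≢⇒< m≤x m≢x) (subst (x <_) (+-suc m k) x<m+k))

range-unique : ∀ m k → Unique (range m k)
range-unique m zero    = []
range-unique m (suc k) =
  All.tabulate (λ x∈ m≡x → <-irrefl m≡x (proj₁ (∈-range⁻ (suc m) k x∈))) ∷ range-unique (suc m) k

length-range : ∀ m k → length (range m k) ≡ k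
length-range m zero    = refl
length-range m (suc k) = cong suc (length-range (suc m) k)

range-snoc : ∀ m k → range m k ++ [ m + k ] ≡ range m (suc k)
range-snoc m zero    = cong [_] (+-identityʳ m)
range-snoc m (suc k) =
  cong (m ∷_) (trans (cong (λ x → range (suc m) k ++ [ x ]) (+-suc m k)) (range-snoc (suc m) k))

Adjacent-range : ∀ m k {a c} → Adjacent a c (range m k) → c ≡ suc a
Adjacent-range m (suc (suc k)) ([]    , _ , refl) = refl
Adjacent-range m (suc zero)    ([]    , _ , ())
Adjacent-range m (suc k)       (_ ∷ l , r , eq)   = Adjacent-range (suc m) k (l , r , ∷-injectiveʳ eq)

data BlockWord : ℕ → List ℕ → Set where
  []    : BlockWord 0 []
  block : ∀ {l u} k → BlockWord l u → BlockWord (suc (l + k)) (u ++ l + k ∷ range l k)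

record PermWord (n : ℕ) (w : List ℕ) : Set where
  constructor permWord
  field
    unique  : Unique w
    bounded : ∀ {x} → x ∈ w → x < n
    covers  : ∀ {x} → x < n → x ∈ w

∈-block⁻ : ∀ l k {x} → x ∈ l + k ∷ range l k → l ≤ x × x < suc (l + k)
∈-block⁻ l k (here refl) = m≤m+n l k , ≤-refl
∈-block⁻ l k (there x∈) with ∈-range⁻ l k x∈
... | l≤x , x<l+k = l≤x , m<n⇒m<1+n x<l+k

∈-block⁺ : ∀ l k {x} → l ≤ x → x < suc (l + k) → x ∈ l + k ∷ range l k
∈-block⁺ l k l≤x x<1+l+k with m≤n⇒m<n∨m≡n (s≤s⁻¹ x<1+l+k)
... | inj₁ x<l+k = there (∈-range⁺ l k l≤x x<l+k)
... | inj₂ refl  = here refl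

PermWord-block⁺ : ∀ {l u} k → PermWord l u → PermWord (suc (l + k)) (u ++ l + k ∷ range l k)
PermWord-block⁺ {l} {u} k (permWord unique bounded covers) =
  permWord (Uniqueₚ.++⁺ unique block-unique disjoint) bounded′ covers′
  where
  block-unique : Unique (l + k ∷ range l k)
  block-unique =
    All.tabulate (λ x∈ l+k≡x → <-irrefl (sym l+k≡x) (proj₂ (∈-range⁻ l k x∈))) ∷ range-unique l k
  disjoint : ∀ {x} → ¬ (x ∈ u × x ∈ l + k ∷ range l k)
  disjoint (x∈u , x∈b) = <⇒≱ (bounded x∈u) (proj₁ (∈-block⁻ l k x∈b))
  bounded′ : ∀ {x} → x ∈ u ++ l + k ∷ range l k → x < suc (l + k)
  bounded′ x∈ with ∈-++⁻ u x∈
  ... | inj₁ x∈u = m<n⇒m<1+n (<-≤-trans (bounded x∈u) (m≤m+n l k))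
  ... | inj₂ x∈b = proj₂ (∈-block⁻ l k x∈b)
  covers′ : ∀ {x} → x < suc (l + k) → x ∈ u ++ l + k ∷ range l k
  covers′ {x} x< with x <? l
  ... | yes x<l = ∈-++⁺ˡ (covers x<l)
  ... | no  x≮l = ∈-++⁺ʳ u (∈-block⁺ l k (≮⇒≥ x≮l) x<)

PermWord-block⁻ : ∀ {l u} k → PermWord (suc (l + k)) (u ++ l + k ∷ range l k) → PermWord l u
PermWord-block⁻ {l} {u} k (permWord unique bounded covers) =
  permWord (Unique-++⁻ˡ u unique) bounded′ covers′
  where
  bounded′ : ∀ {x} → x ∈ u → x < l
  bounded′ {x} x∈u with x <? l
  ... | yes x<l = x<l
  ... | no  x≮l = ⊥-elim (Unique-++-disjoint u unique x∈u
                           (∈-block⁺ l k (≮⇒≥ x≮l) (bounded (∈-++⁺ˡ x∈u))))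
  covers′ : ∀ {x} → x < l → x ∈ u
  covers′ x<l with ∈-++⁻ u (covers (m<n⇒m<1+n (<-≤-trans x<l (m≤m+n l k))))
  ... | inj₁ x∈u = x∈u
  ... | inj₂ x∈b = ⊥-elim (<⇒≱ x<l (proj₁ (∈-block⁻ l k x∈b)))

BlockWord⇒PermWord : ∀ {n w} → BlockWord n w → PermWord n w
BlockWord⇒PermWord []           = permWord [] (λ ()) (λ ())
BlockWord⇒PermWord (block k bw) = PermWord-block⁺ k (BlockWord⇒PermWord bw)

length-BlockWord : ∀ {n w} → BlockWord n w → length w ≡ n
length-BlockWord [] = refl
length-BlockWord (block {l} {u} k bw) = begin
  length (u ++ l + k ∷ range l k)     ≡⟨ length-++ u ⟩
  length u + suc (length (range l k)) ≡⟨ cong₂ (λ a b → a + suc b) (length-BlockWord bw) (length-range l k) ⟩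
  l + suc k                           ≡⟨ +-suc l k ⟩
  suc (l + k)                         ∎
  where open ≡-Reasoning

record StdForm (cs : List (List⁺ ℕ)) (w : List ℕ) : Set where
  constructor stdForm
  field
    flattens  : flatten cs ≡ w
    headsMax  : HeadsMax _<_ cs
    headsIncr : Linked (_<_ on head) cs

-- Repeating the head turns the wrap-around step of a cycle into an ordinary adjacency.
Step : List⁺ ℕ → ℕ → ℕ → Set
Step C a c = Adjacent a c (toList C ++ [ head C ])

Next : List (List⁺ ℕ) → ℕ → ℕ → Set
Next cs a c = ∃ λ C → C ∈ cs × Step C a c

StdForm-split-at-max : ∀ cs {u N t} → StdForm cs (u ++ N ∷ t) → All (_< N) u → All (_< N) t →
                       ∃ λ cs₀ → cs ≡ cs₀ ++ [ N ∷ t ] × StdForm cs₀ u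
StdForm-split-at-max [] {[]}    (stdForm () _ _) _ _
StdForm-split-at-max [] {_ ∷ _} (stdForm () _ _) _ _
StdForm-split-at-max ((h ∷ t′) ∷ []) {[]} (stdForm eq _ _) _ _ with ∷-injective eq
... | refl , refl = [] , cong (λ t → [ h ∷ t ]) (sym (++-identityʳ t′)) , stdForm refl [] []
StdForm-split-at-max ((h ∷ t′) ∷ (h₂ ∷ _) ∷ _) {[]} (stdForm eq _ (h<h₂ ∷ _)) _ t<N
  with ∷-injective eq
... | refl , eq′ = ⊥-elim (<-asym h<h₂ (All.lookup t<N (subst (h₂ ∈_) eq′ (∈-++⁺ʳ t′ (here refl)))))
StdForm-split-at-max ((h ∷ t′) ∷ cs) {x ∷ u} (stdForm eq (t′<h ∷ headsMax) headsIncr) (x<N ∷ u<N) t<N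
  with ∷-injective eq
... | refl , eq′ with split-in-suffix t′ (λ N∈t′ → <-asym x<N (All.lookup t′<h N∈t′)) eq′
... | u′ , refl , eq″
  with StdForm-split-at-max cs (stdForm eq″ headsMax (Linked.tail headsIncr)) (Allₚ.++⁻ʳ t′ u<N) t<N
... | cs₀ , refl , stdForm refl headsMax₀ _ =
  (h ∷ t′) ∷ cs₀ , refl ,
  stdForm refl (t′<h ∷ headsMax₀) (Linked-++⁻ˡ ((h ∷ t′) ∷ cs₀) headsIncr)

Step-block-≤ : ∀ l k {a c} → Step (l + k ∷ range l k) a c → c ≤ suc a
Step-block-≤ l k (L , r , eq) rewrite range-snoc l k with L
... | []    with ∷-injective eq
...   | refl , eq′ = ≤-trans (≤-reflexive (sym (∷-injectiveˡ eq′))) (m≤n⇒m≤1+n (m≤m+n l k))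
Step-block-≤ l k (L , r , eq) | _ ∷ L′ =
  ≤-reflexive (Adjacent-range l (suc k) (L′ , r , ∷-injectiveʳ eq))

BlockWord-Next-≤ : ∀ {n w cs a c} → BlockWord n w → StdForm cs w → Next cs a c → c ≤ suc a
BlockWord-Next-≤ {cs = []}          [] _                (_ , () , _)
BlockWord-Next-≤ {cs = (_ ∷ _) ∷ _} [] (stdForm () _ _) _
BlockWord-Next-≤ (block {l} {u} k bw) sf (C , C∈ , step)
  with StdForm-split-at-max _ sf u<N (All.tabulate (proj₂ ∘ ∈-range⁻ l k))
  where
  u<N : All (_< l + k) u
  u<N = All.tabulate (λ x∈u → <-≤-trans (PermWord.bounded (BlockWord⇒PermWord bw) x∈u) (m≤m+n l k))
... | cs₀ , refl , sf₀ with ∈-++⁻ cs₀ C∈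
...   | inj₁ C∈cs₀       = BlockWord-Next-≤ bw sf₀ (C , C∈cs₀ , step)
...   | inj₂ (here refl) = Step-block-≤ l k step

-- The last cycle of an avoider

Avoiding : List (List⁺ ℕ) → List ℕ → Set
Avoiding cs w = ∀ {a b c} → Before b a w → a < b → b < c → Next cs a c → ⊥

PermWord-below-max : ∀ {N} u {t} → PermWord (suc N) (u ++ N ∷ t) → All (_< N) u × All (_< N) t
PermWord-below-max {N} u {t} (permWord unique bounded _) =
  All.tabulate (λ x∈u → below (∈-++⁺ˡ x∈u)
                              (λ { refl → Unique-++-disjoint u unique x∈u (here refl) })) ,
  All.tabulate (λ x∈t → below (∈-++⁺ʳ u (there x∈t))
                              (λ { refl → Uniqueₚ.Unique[x∷xs]⇒x∉xs (Unique-++⁻ʳ u unique) x∈t }))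
  where
  below : ∀ {x} → x ∈ u ++ N ∷ t → x ≢ N → x < N
  below x∈ x≢N = ≤∧≢⇒< (s≤s⁻¹ (bounded x∈)) x≢N

module _ {u N t} (perm : PermWord (suc N) (u ++ N ∷ t)) (t<N : All (_< N) t)
         (avoiding : ∀ {a b c} → Before b a (u ++ N ∷ t) → a < b → b < c → Step (N ∷ t) a c → ⊥) where

  open PermWord perm

  run-step : ∀ p c s m → t ≡ p ++ c ∷ s → s ≡ range m (length s) → m + length s ≡ N → Step (N ∷ t) c m
  run-step p c s m t≡ s≡ m+k≡N = N ∷ p , range (suc m) k , (begin
    N ∷ t ++ [ N ]                      ≡⟨ cong (λ t → N ∷ t ++ [ N ]) t≡ ⟩
    N ∷ (p ++ c ∷ s) ++ [ N ]           ≡⟨ cong (N ∷_) (++-assoc p (c ∷ s) [ N ]) ⟩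
    N ∷ p ++ c ∷ s ++ [ N ]             ≡⟨ cong₂ (λ s x → N ∷ p ++ c ∷ s ++ [ x ]) s≡ (sym m+k≡N) ⟩
    N ∷ p ++ c ∷ range m k ++ [ m + k ] ≡⟨ cong (λ r → N ∷ p ++ c ∷ r) (range-snoc m k) ⟩
    N ∷ p ++ c ∷ m ∷ range (suc m) k    ∎)
    where
    open ≡-Reasoning
    k = length s

  run-extend : ∀ p c s m → t ≡ p ++ c ∷ s → s ≡ range m (length s) → m + length s ≡ N →
               ∃ λ m′ → c ∷ s ≡ range m′ (suc (length s)) × m′ + suc (length s) ≡ N
  run-extend p c s m t≡ s≡ m+k≡N = conclude (c ≟ pred m)
    where
    k = length s
    w≡ : u ++ N ∷ t ≡ (u ++ N ∷ p) ++ c ∷ s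
    w≡ = trans (cong (λ t → u ++ N ∷ t) t≡) (sym (++-assoc u (N ∷ p) (c ∷ s)))
    c<m : c < m
    c<m with c <? m
    ... | yes c<m = c<m
    ... | no  c≮m = ⊥-elim (c∉s (subst (c ∈_) (sym s≡) (∈-range⁺ m k (≮⇒≥ c≮m) (subst (c <_) (sym m+k≡N) c<N))))
      where
      c∉s : c ∉ s
      c∉s = Uniqueₚ.Unique[x∷xs]⇒x∉xs (Unique-++⁻ʳ (u ++ N ∷ p) (subst Unique w≡ unique))
      c<N : c < N
      c<N = All.lookup t<N (subst (c ∈_) (sym t≡) (∈-++⁺ʳ p (here refl)))
    1+pred[m]≡m : suc (pred m) ≡ m
    1+pred[m]≡m = suc-pred m {{>-nonZero (≤-<-trans z≤n c<m)}}
    conclude : Dec (c ≡ pred m) → ∃ λ m′ → c ∷ s ≡ range m′ (suc k) × m′ + suc k ≡ N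
    conclude (yes c≡v) = pred m ,
      cong₂ _∷_ c≡v (trans s≡ (cong (λ x → range x k) (sym 1+pred[m]≡m))) ,
      trans (+-suc (pred m) k) (trans (cong (_+ k) 1+pred[m]≡m) m+k≡N)
    conclude (no c≢v) = ⊥-elim (avoiding before c<v v<m (run-step p c s m t≡ s≡ m+k≡N))
      where
      v<m : pred m < m
      v<m = subst (pred m <_) 1+pred[m]≡m (n<1+n (pred m))
      c<v : c < pred m
      c<v = ≤∧≢⇒< (<⇒≤pred c<m) c≢v
      v<1+N : pred m < suc N
      v<1+N = m<n⇒m<1+n (<-≤-trans v<m (subst (m ≤_) m+k≡N (m≤m+n m k)))
      before : Before (pred m) c (u ++ N ∷ t)
      before with ∈-++⁻ (u ++ N ∷ p) (subst (pred m ∈_) w≡ (covers v<1+N))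
      ... | inj₁ v∈pre       = u ++ N ∷ p , s , w≡ , v∈pre
      ... | inj₂ (here v≡c)  = ⊥-elim (c≢v (sym v≡c))
      ... | inj₂ (there v∈s) = ⊥-elim (<⇒≱ v<m (proj₁ (∈-range⁻ m k (subst (pred m ∈_) s≡ v∈s))))

  suffix-run : ∀ p s → t ≡ p ++ s → ∃ λ m → s ≡ range m (length s) × m + length s ≡ N
  suffix-run p []      _  = N , refl , +-identityʳ N
  suffix-run p (c ∷ s) t≡ with suffix-run (p ++ [ c ]) s (trans t≡ (sym (++-assoc p [ c ] s)))
  ... | m , s≡ , m+k≡N = run-extend p c s m t≡ s≡ m+k≡N

  last-cycle-run : ∃₂ λ l k → t ≡ range l k × l + k ≡ N
  last-cycle-run with suffix-run [] t refl
  ... | l , t≡ , l+k≡N = l , length t , t≡ , l+k≡N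

Avoiding⇒BlockWord : ∀ {n w cs} → Acc _<_ n → PermWord n w → StdForm cs w → Avoiding cs w → BlockWord n w
Avoiding⇒BlockWord {zero} {[]}    _ _    _ _ = []
Avoiding⇒BlockWord {zero} {_ ∷ _} _ perm _ _ = ⊥-elim (n≮0 (PermWord.bounded perm (here refl)))
Avoiding⇒BlockWord {suc N} {cs = cs} (acc rs) perm sf avoiding
  with ∈-∃++ (PermWord.covers perm (n<1+n N))
... | u , t , refl with PermWord-below-max u perm
... | u<N , t<N with StdForm-split-at-max cs sf u<N t<N
... | cs₀ , refl , sf₀
  with last-cycle-run perm t<N (λ bef a<b b<c step → avoiding bef a<b b<c (_ , ∈-++⁺ʳ cs₀ (here refl) , step))
... | l , k , refl , refl =
  block k (Avoiding⇒BlockWord (rs (s≤s (m≤m+n l k))) (PermWord-block⁻ k perm) sf₀ avoiding₀)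
  where
  avoiding₀ : Avoiding cs₀ u
  avoiding₀ bef a<b b<c (C , C∈ , step) = avoiding (Before-++ʳ _ bef) a<b b<c (C , ∈-++⁺ˡ C∈ , step)

-- Counting block words

-- (u , l , k) stands for the block word u of size l, still to be followed by a block with top l + k.
Split : Set
Split = List ℕ × ℕ × ℕ

blockOf : Split → List ℕ
blockOf (u , l , k) = u ++ l + k ∷ range l k

seal : Split → Split
seal s@(_ , l , k) = blockOf s , suc (l + k) , 0

widen : Split → Split
widen (u , l , k) = u , l , suc k

splits : ℕ → List Split
splits zero    = [ [] , 0 , 0 ]
splits (suc N) = map seal (splits N) ++ map widen (splits N)

∈-splits⁻ : ∀ N {u l k} → (u , l , k) ∈ splits N → BlockWord l u × l + k ≡ N
∈-splits⁻ zero    (here refl) = [] , refl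
∈-splits⁻ (suc N) s∈ with ∈-++⁻ (map seal (splits N)) s∈
... | inj₁ s∈seal with ∈-map⁻ seal s∈seal
...   | (_ , l , k) , s′∈ , refl with ∈-splits⁻ N s′∈
...     | bw , l+k≡N = block k bw , cong suc (trans (+-identityʳ (l + k)) l+k≡N)
∈-splits⁻ (suc N) s∈ | inj₂ s∈widen with ∈-map⁻ widen s∈widen
...   | (_ , l , k) , s′∈ , refl with ∈-splits⁻ N s′∈
...     | bw , l+k≡N = bw , trans (+-suc l k) (cong suc l+k≡N)

∈-splits⁺ : ∀ {N u l} k → BlockWord l u → l + k ≡ N → (u , l , k) ∈ splits N
∈-splits⁺ {suc N} {l = l} (suc k) bw l+k≡N =
  ∈-++⁺ʳ _ (∈-map⁺ widen (∈-splits⁺ k bw (suc-injective (trans (sym (+-suc l k)) l+k≡N))))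
∈-splits⁺ zero []               refl = here refl
∈-splits⁺ zero (block {l} k bw) refl =
  ∈-++⁺ˡ (∈-map⁺ seal (∈-splits⁺ k bw (sym (+-identityʳ (l + k)))))

blockOf-injective : ∀ N {s s′} → s ∈ splits N → s′ ∈ splits N → blockOf s ≡ blockOf s′ → s ≡ s′
blockOf-injective N {u , l , k} {u′ , l′ , k′} s∈ s′∈ eq
  with ∈-splits⁻ N s∈ | ∈-splits⁻ N s′∈
... | bw , l+k≡N | bw′ , l′+k′≡N
  with split-unique u (N∉ bw l+k≡N) (N∉ bw′ l′+k′≡N)
         (subst₂ (λ x y → u ++ x ∷ range l k ≡ u′ ++ y ∷ range l′ k′) l+k≡N l′+k′≡N eq)
  where
  N∉ : ∀ {l u k} → BlockWord l u → l + k ≡ N → N ∉ u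
  N∉ {l} {k = k} bw l+k≡N N∈u =
    <⇒≱ (PermWord.bounded (BlockWord⇒PermWord bw) N∈u) (subst (l ≤_) l+k≡N (m≤m+n l k))
... | refl , range≡ with trans (sym (length-range l k)) (trans (cong length range≡) (length-range l′ k′))
...   | refl = cong (λ l → u , l , k) (+-cancelʳ-≡ k l l′ (trans l+k≡N (sym l′+k′≡N)))

splits-unique : ∀ N → Unique (splits N)
splits-unique zero    = [] ∷ []
splits-unique (suc N) =
  Uniqueₚ.++⁺ (Unique-map⁺-on seal (λ s∈ s′∈ → blockOf-injective N s∈ s′∈ ∘ cong proj₁)
                              (splits-unique N))
              (Uniqueₚ.map⁺ widen-injective (splits-unique N))
              disjoint
  where
  widen-injective : ∀ {s s′} → widen s ≡ widen s′ → s ≡ s′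
  widen-injective refl = refl
  disjoint : ∀ {s} → ¬ (s ∈ map seal (splits N) × s ∈ map widen (splits N))
  disjoint (s∈seal , s∈widen) with ∈-map⁻ seal s∈seal | ∈-map⁻ widen s∈widen
  ... | _ , _ , refl | _ , _ , ()

length-splits : ∀ N → length (splits N) ≡ 2 ^ N
length-splits zero    = refl
length-splits (suc N) = begin
  length (map seal (splits N) ++ map widen (splits N))         ≡⟨ length-++ (map seal (splits N)) ⟩
  length (map seal (splits N)) + length (map widen (splits N))
    ≡⟨ cong₂ _+_ (length-map seal (splits N)) (length-map widen (splits N)) ⟩
  length (splits N) + length (splits N)                        ≡⟨ cong (λ m → m + m) (length-splits N) ⟩
  2 ^ N + 2 ^ N                                                ≡⟨ cong (2 ^ N +_) (sym (+-identityʳ (2 ^ N))) ⟩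
  2 ^ suc N                                                    ∎
  where open ≡-Reasoning

BlockWord-count : ∀ N → HasCount (BlockWord (suc N)) (2 ^ N)
BlockWord-count N =
  map blockOf (splits N) ,
  Unique-map⁺-on blockOf (blockOf-injective N) (splits-unique N) ,
  (λ w → mk⇔ listed⇒BlockWord BlockWord⇒listed) ,
  trans (length-map blockOf (splits N)) (length-splits N)
  where
  listed⇒BlockWord : ∀ {w} → w ∈ map blockOf (splits N) → BlockWord (suc N) w
  listed⇒BlockWord w∈ with ∈-map⁻ blockOf w∈
  ... | (u , l , k) , s∈ , refl with ∈-splits⁻ N s∈
  ...   | bw , l+k≡N = subst (λ n → BlockWord (suc n) (blockOf (u , l , k))) l+k≡N (block k bw)
  BlockWord⇒listed : ∀ {w} → BlockWord (suc N) w → w ∈ map blockOf (splits N)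
  BlockWord⇒listed (block k bw) = ∈-map⁺ blockOf (∈-splits⁺ k bw refl)

word : ∀ {n k} → Vec (Fin n) k → List ℕ
word π = map toℕ (Vec.toList π)

-- Letters are reduced modulo N+1 and a word that is too short is padded with 0.
toVec : ∀ {N} k → List ℕ → Vec (Fin (suc N)) k
toVec     zero    _       = []
toVec     (suc k) []      = zero ∷ toVec k []
toVec {N} (suc k) (x ∷ w) = x mod suc N ∷ toVec k w

toVec-word : ∀ {N k} (π : Vec (Fin (suc N)) k) → toVec k (word π) ≡ π
toVec-word []      = refl
toVec-word (i ∷ π) =
  cong₂ _∷_ (toℕ-injective (trans (toℕ-fromℕ< _) (m<n⇒m%n≡m (toℕ<n i)))) (toVec-word π)

word-toVec : ∀ {N} k w → length w ≡ k → All (_< suc N) w → word (toVec {N} k w) ≡ w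
word-toVec zero    []      _   _            = refl
word-toVec (suc k) (x ∷ w) len (x<1+N ∷ w<) =
  cong₂ _∷_ (trans (toℕ-fromℕ< _) (m<n⇒m%n≡m x<1+N)) (word-toVec k w (suc-injective len) w<)

Before⇒indices : ∀ {A B : Set} (g : A → B) {k} (v : Vec A k) {a b} → Before b a (map g (Vec.toList v)) →
                 ∃₂ λ i j → i Fin.< j × g (lookup v i) ≡ b × g (lookup v j) ≡ a
Before⇒indices g (x ∷ v) ([] , _ , _ , ())
Before⇒indices g (x ∷ v) {a} (y ∷ l , r , eq , b∈) with ∷-injective eq | b∈
... | refl , eq′ | here refl with ∈-map⁻ g (subst (a ∈_) (sym eq′) (∈-++⁺ʳ l (here refl)))
...   | a′ , a′∈ , refl =
  zero , suc (VecAny.index a′∈v) , z<s , refl , cong g (sym (VecAnyₚ.lookup-index a′∈v))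
  where a′∈v = ∈-toList⁻ a′∈
Before⇒indices g (x ∷ v) (y ∷ l , r , eq , b∈) | refl , eq′ | there b∈l
  with Before⇒indices g v (l , r , eq′ , b∈l)
... | i , j , i<j , gi , gj = suc i , suc j , s<s i<j , gi , gj

AllPairs⇒strictInc : ∀ {n k} {v : Vec (Fin n) k} → VecAllPairs Fin._<_ v → StrictInc (lookup v)
AllPairs⇒strictInc (v₀< ∷ _)    zero    (suc j) _         = VecAllₚ.lookup⁺ v₀< j
AllPairs⇒strictInc (_ ∷ sorted) (suc i) (suc j) (s<s i<j) = AllPairs⇒strictInc sorted i j i<j

IsPerm⇒∈ : ∀ {n} (π : Vec (Fin n) n) → IsPerm π → ∀ y → y ∈ Vec.toList π
IsPerm⇒∈ {suc m} π isPerm y with Finₚ.any? (λ i → lookup π i Fin.≟ y)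
... | yes (i , refl) = ∈-toList⁺ (∈-lookup i π)
... | no  y∉π        = ⊥-elim (collision (Finₚ.pigeonhole (n<1+n m) (λ i → Fin.punchOut (y≢ i))))
  where
  y≢ : ∀ i → y ≢ lookup π i
  y≢ i y≡πi = y∉π (i , sym y≡πi)
  collision : ¬ ∃₂ λ i j → i Fin.< j × Fin.punchOut (y≢ i) ≡ Fin.punchOut (y≢ j)
  collision (i , j , i<j , eq) =
    <-irrefl (cong toℕ (isPerm i j (Finₚ.punchOut-injective (y≢ i) (y≢ j) eq))) i<j

module _ {A : Set} where

  Unique-toList⁺ : ∀ {k} {v : Vec A k} → VecUnique v → Unique (Vec.toList v)
  Unique-toList⁺ []       = []
  Unique-toList⁺ (x∉ ∷ u) = VecAllₚ.toList⁺ x∉ ∷ Unique-toList⁺ u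

  Unique-toList⁻ : ∀ {k} {v : Vec A k} → Unique (Vec.toList v) → VecUnique v
  Unique-toList⁻ {v = []}    []       = []
  Unique-toList⁻ {v = _ ∷ _} (x∉ ∷ u) = VecAllₚ.toList⁻ x∉ ∷ Unique-toList⁻ u

IsPerm⇒Unique : ∀ {n} (π : Vec (Fin n) n) → IsPerm π → Unique (Vec.toList π)
IsPerm⇒Unique π isPerm =
  Unique-toList⁺ (subst VecUnique (Vecₚ.tabulate∘lookup π) (VecUniqueₚ.tabulate⁺ (isPerm _ _)))

Unique⇒IsPerm : ∀ {n} {π : Vec (Fin n) n} → Unique (Vec.toList π) → IsPerm π
Unique⇒IsPerm = VecUniqueₚ.lookup-injective ∘ Unique-toList⁻

IsPerm⇒PermWord : ∀ {n} (π : Vec (Fin n) n) → IsPerm π → PermWord n (word π)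
IsPerm⇒PermWord {n} π isPerm = permWord (Uniqueₚ.map⁺ toℕ-injective (IsPerm⇒Unique π isPerm)) bounded covers
  where
  bounded : ∀ {x} → x ∈ word π → x < n
  bounded x∈ with ∈-map⁻ toℕ x∈
  ... | i , _ , refl = toℕ<n i
  covers : ∀ {x} → x < n → x ∈ word π
  covers x<n = subst (_∈ word π) (toℕ-fromℕ< x<n) (∈-map⁺ toℕ (IsPerm⇒∈ π isPerm (Fin.fromℕ< x<n)))

IsPerm⇒↭allFin : ∀ {n} (π : Vec (Fin n) n) → IsPerm π → Vec.toList π ↭ List.allFin n
IsPerm⇒↭allFin {n} π isPerm =
  ∼bag⇒↭ (unique∧set⇒bag (IsPerm⇒Unique π isPerm) (Uniqueₚ.allFin⁺ n)
            (λ {y} → mk⇔ (λ _ → ∈-allFin y) (λ _ → IsPerm⇒∈ π isPerm y)))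

module _ {n : ℕ} {σ : Fin n → Fin n} where

  CycleChain⇒Linked : ∀ {f} x xs → CycleChain σ f (x ∷ xs) →
                      Linked (λ a b → σ a ≡ b) ((x ∷ xs) ++ [ f ])
  CycleChain⇒Linked x []       σx≡f        = σx≡f ∷ [-]
  CycleChain⇒Linked x (y ∷ xs) (σx≡y , ch) = σx≡y ∷ CycleChain⇒Linked y xs ch

  Linked⇒CycleChain : ∀ {f} x xs → Linked (λ a b → σ a ≡ b) ((x ∷ xs) ++ [ f ]) →
                      CycleChain σ f (x ∷ xs)
  Linked⇒CycleChain x []       lk          = Linked.head lk
  Linked⇒CycleChain x (y ∷ xs) (σx≡y ∷ lk) = σx≡y , Linked⇒CycleChain y xs lk

ℕcycles : ∀ {n} → List (List⁺ (Fin n)) → List (List⁺ ℕ)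
ℕcycles = map (List⁺.map toℕ)

flatten-ℕcycles : ∀ {n} (cs : List (List⁺ (Fin n))) → flatten (ℕcycles cs) ≡ map toℕ (flatten cs)
flatten-ℕcycles []             = refl
flatten-ℕcycles ((h ∷ t) ∷ cs) =
  cong (toℕ h ∷_) (trans (cong (map toℕ t ++_) (flatten-ℕcycles cs)) (sym (map-++ toℕ t (flatten cs))))

module _ {n : ℕ} {σ : Fin n → Fin n} {π : Vec (Fin n) n} (θ : Theta σ π) where

  private
    cs   = proj₁ θ
    std  = proj₁ (proj₁ (proj₂ θ))
    incr = proj₁ (proj₂ (proj₁ (proj₂ θ)))
    perm = proj₂ (proj₂ (proj₁ (proj₂ θ)))
    flat = proj₂ (proj₂ θ)

  Theta⇒StdForm : StdForm (ℕcycles cs) (word π)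
  Theta⇒StdForm =
    stdForm (trans (flatten-ℕcycles cs) (cong (map toℕ) flat))
            (Allₚ.map⁺ (All.map (Allₚ.map⁺ ∘ proj₁) std))
            (Linkedₚ.map⁺ (Linkedₚ.map⁻ incr))

  Theta⇒Next : ∀ a → Next (ℕcycles cs) (toℕ a) (toℕ (σ a))
  Theta⇒Next a with ∈-concat⁻′ (map toList cs) (∈-resp-↭ (↭-sym perm) (∈-allFin a))
  ... | _ , a∈C , C∈ with ∈-map⁻ toList C∈
  ... | h ∷ t , C∈cs , refl with ∈⇒Adjacent-snoc (h ∷ t) h a∈C
  ... | c , adj with Linked-Adjacent (CycleChain⇒Linked h t (proj₂ (All.lookup std C∈cs))) adj
  ... | refl =
    List⁺.map toℕ (h ∷ t) , ∈-map⁺ _ C∈cs ,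
    subst (Adjacent _ _) (map-++ toℕ (h ∷ t) [ h ]) (Adjacent-map toℕ adj)

  Next⇒≡σ : ∀ {a c} → Next (ℕcycles cs) (toℕ a) c → toℕ (σ a) ≡ c
  Next⇒≡σ (_ , C∈ , step) with ∈-map⁻ (List⁺.map toℕ) C∈
  ... | h ∷ t , C∈cs , refl
    with Adjacent-map⁻ toℕ ((h ∷ t) ++ [ h ]) (subst (Adjacent _ _) (sym (map-++ toℕ (h ∷ t) [ h ])) step)
  ... | a′ , c′ , adj , a′≡a , refl
    with toℕ-injective a′≡a | Linked-Adjacent (CycleChain⇒Linked h t (proj₂ (All.lookup std C∈cs))) adj
  ... | refl | refl = refl

module _ {n : ℕ} where

  -- Left-to-right maxima open the cycles: x takes over every following cycle with a smaller head.
  absorb : Fin n → List (Fin n) → List (List⁺ (Fin n)) → List (List⁺ (Fin n))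
  absorb x ys []       = [ x ∷ ys ]
  absorb x ys (C ∷ cs) with head C Fin.<? x
  ... | yes _ = absorb x (ys ++ toList C) cs
  ... | no  _ = (x ∷ ys) ∷ C ∷ cs

  cycles : List (Fin n) → List (List⁺ (Fin n))
  cycles []       = []
  cycles (x ∷ xs) = absorb x [] (cycles xs)

  flatten-absorb : ∀ x ys cs → flatten (absorb x ys cs) ≡ x ∷ ys ++ flatten cs
  flatten-absorb x ys []       = refl
  flatten-absorb x ys (C ∷ cs) with head C Fin.<? x
  ... | yes _ = trans (flatten-absorb x (ys ++ toList C) cs) (cong (x ∷_) (++-assoc ys (toList C) (flatten cs)))
  ... | no  _ = refl

  flatten-cycles : ∀ xs → flatten (cycles xs) ≡ xs
  flatten-cycles []       = refl
  flatten-cycles (x ∷ xs) = trans (flatten-absorb x [] (cycles xs)) (cong (x ∷_) (flatten-cycles xs))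

  absorb-headsMax : ∀ x ys cs → All (Fin._< x) ys → HeadsMax Fin._<_ cs → HeadsMax Fin._<_ (absorb x ys cs)
  absorb-headsMax x ys []             ys<x _ = ys<x ∷ []
  absorb-headsMax x ys ((h ∷ t) ∷ cs) ys<x (t<h ∷ headsMax) with h Fin.<? x
  ... | yes h<x = absorb-headsMax x (ys ++ h ∷ t) cs
                    (Allₚ.++⁺ ys<x (h<x ∷ All.map (λ y<h → <-trans y<h h<x) t<h)) headsMax
  ... | no  _   = ys<x ∷ t<h ∷ headsMax

  cycles-headsMax : ∀ xs → HeadsMax Fin._<_ (cycles xs)
  cycles-headsMax []       = []
  cycles-headsMax (x ∷ xs) = absorb-headsMax x [] (cycles xs) [] (cycles-headsMax xs)

  absorb-headsIncr : ∀ x ys cs → Linked (Fin._<_ on head) cs → x ∉ flatten cs →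
                     Linked (Fin._<_ on head) (absorb x ys cs)
  absorb-headsIncr x ys []             _    _  = [-]
  absorb-headsIncr x ys ((h ∷ t) ∷ cs) incr x∉ with h Fin.<? x
  ... | yes _   = absorb-headsIncr x (ys ++ h ∷ t) cs (Linked.tail incr) (x∉ ∘ ∈-++⁺ʳ (h ∷ t))
  ... | no  h≮x = ≤∧≢⇒< (≮⇒≥ h≮x) (λ x≡h → x∉ (here (toℕ-injective x≡h))) ∷ incr

  cycles-headsIncr : ∀ xs → Unique xs → Linked (Fin._<_ on head) (cycles xs)
  cycles-headsIncr []       _        = []
  cycles-headsIncr (x ∷ xs) (x∉ ∷ u) =
    absorb-headsIncr x [] (cycles xs) (cycles-headsIncr xs u)
      (λ x∈ → Uniqueₚ.Unique[x∷xs]⇒x∉xs (x∉ ∷ u) (subst (x ∈_) (flatten-cycles xs) x∈))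

  lookupOr : List (Fin n × Fin n) → Fin n → Fin n
  lookupOr []             a = a
  lookupOr ((k , v) ∷ ps) a with k Fin.≟ a
  ... | yes _ = v
  ... | no  _ = lookupOr ps a

  lookupOr-∈ : ∀ ps {k v} → Unique (map proj₁ ps) → (k , v) ∈ ps → lookupOr ps k ≡ v
  lookupOr-∈ ((k′ , v′) ∷ ps) {k} _ (here refl) with k′ Fin.≟ k
  ... | yes _   = refl
  ... | no  k≢k = ⊥-elim (k≢k refl)
  lookupOr-∈ ((k′ , v′) ∷ ps) {k} (k′∉ ∷ u) (there kv∈) with k′ Fin.≟ k
  ... | yes refl = ⊥-elim (Uniqueₚ.Unique[x∷xs]⇒x∉xs (k′∉ ∷ u) (∈-map⁺ proj₁ kv∈))
  ... | no  _    = lookupOr-∈ ps u kv∈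

  cycleLinks : List⁺ (Fin n) → List (Fin n × Fin n)
  cycleLinks C = links (toList C ++ [ head C ])

  successor : List (List⁺ (Fin n)) → Fin n → Fin n
  successor cs = lookupOr (concat (map cycleLinks cs))

  keys-cycleLinks : ∀ cs → map proj₁ (concat (map cycleLinks cs)) ≡ flatten cs
  keys-cycleLinks []       = refl
  keys-cycleLinks (C ∷ cs) = trans (map-++ proj₁ (cycleLinks C) _)
                                   (cong₂ _++_ (keys-links (toList C) (head C)) (keys-cycleLinks cs))

Theta-exists : ∀ {n} (π : Vec (Fin n) n) → IsPerm π → ∃ λ σ → Theta σ π
Theta-exists {n} π isPerm =
  successor cs ,
  cs ,
  (All.tabulate std-cycle ,
   Linkedₚ.map⁺ (cycles-headsIncr _ (IsPerm⇒Unique π isPerm)) ,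
   subst (_↭ List.allFin n) (sym (flatten-cycles _)) (IsPerm⇒↭allFin π isPerm)) ,
  flatten-cycles _
  where
  cs = cycles (Vec.toList π)
  keys-unique : Unique (map proj₁ (concat (map cycleLinks cs)))
  keys-unique = subst Unique (sym (trans (keys-cycleLinks cs) (flatten-cycles _))) (IsPerm⇒Unique π isPerm)
  std-cycle : ∀ {C} → C ∈ cs → IsStdCycle (successor cs) C
  std-cycle {h ∷ t} C∈ =
    All.lookup (cycles-headsMax (Vec.toList π)) C∈ ,
    Linked⇒CycleChain h t (All-links⇒Linked _ (All.tabulate λ l∈ →
      lookupOr-∈ _ keys-unique (∈-concat⁺′ l∈ (∈-map⁺ cycleLinks C∈))))

-- Avoiders are the block words

BlockWord⇒Avoids : ∀ {n} (π : Vec (Fin n) n) → BlockWord n (word π) → Avoids ν21 H13 π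
BlockWord⇒Avoids π bw (x , x-inc , _ , _ , _ , σ , θ , σx₀≡x₂ ∷ []) =
  <⇒≱ (≤-<-trans (x-inc zero (suc zero) z<s) (x-inc (suc zero) (suc (suc zero)) (s<s z<s)))
      (subst (λ y → toℕ y ≤ suc (toℕ (x zero))) σx₀≡x₂
             (BlockWord-Next-≤ bw (Theta⇒StdForm θ) (Theta⇒Next θ (x zero))))

Avoids⇒Avoiding : ∀ {n σ} {π : Vec (Fin n) n} (θ : Theta σ π) → Avoids ν21 H13 π →
                  Avoiding (ℕcycles (proj₁ θ)) (word π)
Avoids⇒Avoiding {σ = σ} {π} θ avoids before a<b b<c next with Before⇒indices toℕ π before
... | i , j , i<j , refl , refl =
  avoids (lookup x , AllPairs⇒strictInc x-sorted ,
          lookup (i ∷ j ∷ []) , AllPairs⇒strictInc ((i<j ∷ []) ∷ [] ∷ []) ,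
          (λ { zero → refl ; (suc zero) → refl }) ,
          σ , θ , refl ∷ [])
  where
  x : Vec (Fin _) 3
  x = lookup π j ∷ lookup π i ∷ σ (lookup π j) ∷ []
  b<σa : toℕ (lookup π i) < toℕ (σ (lookup π j))
  b<σa = subst (_ <_) (sym (Next⇒≡σ θ next)) b<c
  x-sorted : VecAllPairs Fin._<_ x
  x-sorted = (a<b ∷ <-trans a<b b<σa ∷ []) ∷ (b<σa ∷ []) ∷ [] ∷ []

avoider⇔BlockWord : ∀ {n} (π : Vec (Fin n) n) → (IsPerm π × Avoids ν21 H13 π) ⇔ BlockWord n (word π)
avoider⇔BlockWord π = mk⇔
  (λ (isPerm , avoids) → let σ , θ = Theta-exists π isPerm in
    Avoiding⇒BlockWord (<-wellFounded _) (IsPerm⇒PermWord π isPerm)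
                       (Theta⇒StdForm θ) (Avoids⇒Avoiding θ avoids))
  (λ bw → Unique⇒IsPerm (Uniqueₚ.map⁻ (PermWord.unique (BlockWord⇒PermWord bw))) , BlockWord⇒Avoids π bw)

theorem4p5 : (n : ℕ) → n ≥ 1 → AvoidCount n ν21 H13 (2 ^ (n ∸ 1))
theorem4p5 zero    ()
theorem4p5 (suc N) _ =
  HasCount-retract word (toVec (suc N)) toVec-word word-toVec-on-BlockWord avoider⇔BlockWord (BlockWord-count N)
  where
  word-toVec-on-BlockWord : ∀ {w} → BlockWord (suc N) w → word (toVec (suc N) w) ≡ w
  word-toVec-on-BlockWord bw =
    word-toVec (suc N) _ (length-BlockWord bw) (All.tabulate (PermWord.bounded (BlockWord⇒PermWord bw)))
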